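{- Let $P$ be a poset on $\{1,\ldots,n\}$, let $M$ be a maximum independent set of $G_P$ and let $J\in M$. Then there is a unique $j$ with $J\setminus\mu(M,J)=\{j\}$, and $j$ is a maximal element of $J$ with respect to $\le_P$. Moreover, $J_r\setminus\mu(M,J_r)\neq J_s\setminus\mu(M,J_s)$ for any distinct $J_r,J_s\in M$.
   Context: An order ideal of $P$ is a subset $J$ with $i\in J$, $j\le_P i\Rightarrow j\in J$; a nonempty order ideal is connected if the Hasse diagram of $P$ restricted to it is connected. Sets $A,B$ intersect nontrivially if $A\cap B\ne\emptyset$, $A\not\subseteq B$, $B\not\subseteq A$. $G_P$ is the simple graph whose vertices are the connected order ideals of $P$, adjacent iff they intersect nontrivially. A maximum independent set is an independent set of largest possible size. For $J\in M$, $\mu(M,J)=\bigcup_{J'\in M,\,J'\subsetneq J}J'$. -}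

module Defs where

open import Data.Nat using (ℕ; _≤_)
open import Data.Fin using (Fin)
open import Data.Fin.Subset using (Subset; _∈_; _∉_; _⊆_; _∩_; Nonempty; ⋃)
open import Data.Fin.Subset.Properties using (_⊆?_)
open import Data.Bool using (Bool)
import Data.Bool.Properties as BoolP
open import Data.Vec.Properties using (≡-dec)
open import Data.List using (List; filter; length)
open import Data.List.Membership.Propositional renaming (_∈_ to _∈ₗ_)
open import Data.List.Relation.Unary.Unique.Propositional using (Unique)
open import Data.Product using (_×_; Σ; ∃; _,_)
open import Data.Sum using (_⊎_)
open import Relation.Binary.PropositionalEquality using (_≡_; _≢_)
open import Relation.Binary.Structures using (IsPartialOrder)
open import Relation.Nullary using (¬_; ¬?)
open import Relation.Nullary.Decidable using (_×-dec_)
open import Level using (0ℓ)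

record FinPoset (n : ℕ) : Set₁ where
  field
    _≤P_ : Fin n → Fin n → Set
    isPartialOrder : IsPartialOrder _≡_ _≤P_

module _ {n : ℕ} (P : FinPoset n) where
  open FinPoset P

  _<P_ : Fin n → Fin n → Set
  i <P j = i ≤P j × i ≢ j

  _⋖_ : Fin n → Fin n → Set
  i ⋖ j = i <P j × (∀ k → i <P k → ¬ (k <P j))

  HasseAdj : Fin n → Fin n → Set
  HasseAdj i j = (i ⋖ j) ⊎ (j ⋖ i)

  data PathIn (J : Subset n) : Fin n → Fin n → Set where
    here : ∀ {x} → PathIn J x x
    step : ∀ {x y z} → y ∈ J → HasseAdj x y → PathIn J y z → PathIn J x z

  IsOrderIdeal : Subset n → Set
  IsOrderIdeal J = ∀ {i} → i ∈ J → ∀ j → j ≤P i → j ∈ J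

  IsConnected : Subset n → Set
  IsConnected J = Nonempty J × (∀ {x y} → x ∈ J → y ∈ J → PathIn J x y)

  -- vertices of G_P
  IsConnectedIdeal : Subset n → Set
  IsConnectedIdeal J = IsOrderIdeal J × IsConnected J

  -- nontrivial intersection (edges of G_P)
  IntersectNontrivially : Subset n → Subset n → Set
  IntersectNontrivially A B = Nonempty (A ∩ B) × ¬ (A ⊆ B) × ¬ (B ⊆ A)

  -- a finite set of vertices of G_P, given as a duplicate-free list
  IsIndependent : List (Subset n) → Set
  IsIndependent M =
    Unique M
    × (∀ {J} → J ∈ₗ M → IsConnectedIdeal J)
    × (∀ {A B} → A ∈ₗ M → B ∈ₗ M → ¬ IntersectNontrivially A B)

  IsMaximumIndependent : List (Subset n) → Set
  IsMaximumIndependent M =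
    IsIndependent M × (∀ M' → IsIndependent M' → length M' ≤ length M)

  IsMaximalIn : Fin n → Subset n → Set
  IsMaximalIn j J = j ∈ J × (∀ x → x ∈ J → j ≤P x → x ≡ j)

μ : {n : ℕ} → List (Subset n) → Subset n → Subset n
μ M J = ⋃ (filter (λ J' → (J' ⊆? J) ×-dec ¬? (≡-dec BoolP._≟_ J' J)) M)

-- Members of an independent set M pairwise either are disjoint or nested, so the
-- members strictly inside J ∈ M form a laminar family. If they covered J, an exit
-- edge of a Hasse path would always lead from one of them to a strictly larger
-- one, which is impossible. If J ─ μ(M,J) contained x and y with y ≰ x, then ↓x
-- together with every member strictly inside J meeting ↓x would be a connected
-- order ideal, different from J because it misses y, and compatible with all of
-- M: adding it to M would contradict maximality. Decidability of ≤P (needed to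
-- build that ideal as a subset) is not assumed; as each argument derives ⊥, it is
-- available under double negation.
module Submission where

open import Defs
open import Data.Nat using (ℕ)
open import Data.List using (List)
open import Data.Fin using (Fin)
open import Data.Fin.Subset using (Subset; _─_; ⁅_⁆)
open import Data.List.Membership.Propositional using (_∈_)
open import Data.Product using (_×_; Σ)
open import Relation.Binary.PropositionalEquality using (_≡_; _≢_)

open import Data.Nat.Properties using (1+n≰n)
open import Data.Fin using (zero; suc; _≟_)
open import Data.Fin.Properties using (any?)
open import Data.Fin.Subset using (_⊆_; _⊂_; _⊃_; _∪_; ⋃; Nonempty; Empty; inside)
  renaming (_∈_ to _∈ₛ_; _∉_ to _∉ₛ_)
open import Data.Fin.Subset.Properties
  using (_⊆?_; _∈?_; nonempty?; x∈⁅x⁆; x∈⁅y⁆⇒x≡y; ⊆-antisym; ⊆-trans;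
         ∉⊥; x∈p∩q⁺; x∈p∩q⁻; x∈p∪q⁺; x∈p∪q⁻; x∈p∧x∉q⇒x∈p─q; p─q⊆p)
open import Data.Fin.Subset.Induction using (Acc; acc; ⊂-wellFounded; ⊃-wellFounded)
import Data.Bool.Properties as Bool
open import Data.Vec using (_∷_; tabulate)
open import Data.Vec.Base using (here; there)
open import Data.Vec.Properties using (≡-dec; lookup∘tabulate; []=⇒lookup; lookup⇒[]=)
open import Data.List using ([]; _∷_)
open import Data.List.Relation.Unary.Any using (here; there)
import Data.List.Relation.Unary.All as All
open import Data.List.Relation.Unary.AllPairs using (_∷_)
open import Data.List.Membership.Propositional.Properties using (∈-filter⁺; ∈-filter⁻)
open import Data.Product using (_,_; proj₁; proj₂; ∃; ∃₂)
open import Data.Sum using (_⊎_; inj₁; inj₂; swap)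
open import Function using (_∘_; id)
open import Relation.Binary.PropositionalEquality using (refl; sym; trans; subst)
open import Relation.Binary.Structures using (IsPartialOrder)
open import Relation.Binary.Definitions using (Decidable)
open import Relation.Nullary using (¬_; Dec; yes; no; does; ¬?; contradiction)
open import Relation.Nullary.Decidable using (_×-dec_; dec-true; decidable-stable; ¬¬-excluded-middle)
open import Level using (0ℓ)
open import Relation.Unary using (Pred) renaming (Decidable to Decidable₁)

private
  variable
    n : ℕ

¬¬-∀-Fin : {R : Fin n → Set} → (∀ i → ¬ ¬ R i) → ¬ ¬ (∀ i → R i)
¬¬-∀-Fin {ℕ.zero}  ¬¬R ¬∀R = ¬∀R (λ ())
¬¬-∀-Fin {ℕ.suc n} ¬¬R ¬∀R =
  ¬¬R zero λ R0 → ¬¬-∀-Fin (¬¬R ∘ suc) λ Rsuc →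
    ¬∀R λ { zero → R0 ; (suc i) → Rsuc i }

¬¬-decidable : (Q : Pred (Fin n) 0ℓ) → ¬ ¬ Decidable₁ Q
¬¬-decidable Q = ¬¬-∀-Fin (λ _ → ¬¬-excluded-middle)

¬¬-decidable₂ : (R : Fin n → Fin n → Set) → ¬ ¬ Decidable R
¬¬-decidable₂ R = ¬¬-∀-Fin (λ i → ¬¬-decidable (R i))

x∈p─q⇒x∉q : ∀ (p q : Subset n) {x} → x ∈ₛ p ─ q → x ∉ₛ q
x∈p─q⇒x∉q (_ ∷ p) (_ ∷ q) (there x∈p─q) (there x∈q) = x∈p─q⇒x∉q p q x∈p─q x∈q
x∈p─q⇒x∉q (inside ∷ p) (inside ∷ q) () here

x∈⋃⁺ : ∀ {ps : List (Subset n)} {p x} → p ∈ ps → x ∈ₛ p → x ∈ₛ ⋃ ps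
x∈⋃⁺ (here refl) x∈p = x∈p∪q⁺ (inj₁ x∈p)
x∈⋃⁺ (there p∈ps) x∈p = x∈p∪q⁺ (inj₂ (x∈⋃⁺ p∈ps x∈p))

x∈⋃⁻ : ∀ (ps : List (Subset n)) {x} → x ∈ₛ ⋃ ps → ∃ λ p → p ∈ ps × x ∈ₛ p
x∈⋃⁻ [] x∈⊥ = contradiction x∈⊥ ∉⊥
x∈⋃⁻ (p ∷ ps) x∈⋃ with x∈p∪q⁻ p (⋃ ps) x∈⋃
... | inj₁ x∈p = p , here refl , x∈p
... | inj₂ x∈⋃ps with q , q∈ps , x∈q ← x∈⋃⁻ ps x∈⋃ps = q , there q∈ps , x∈q

x∈p∧p⊆⁅x⁆⇒p≡⁅x⁆ : ∀ {p : Subset n} {x} → x ∈ₛ p → (∀ {y} → y ∈ₛ p → y ≡ x) → p ≡ ⁅ x ⁆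
x∈p∧p⊆⁅x⁆⇒p≡⁅x⁆ {x = x} x∈p unique =
  ⊆-antisym (λ y∈p → subst (_∈ₛ ⁅ x ⁆) (sym (unique y∈p)) (x∈⁅x⁆ x))
            (λ {y} y∈⁅x⁆ → subst (_∈ₛ _) (sym (x∈⁅y⁆⇒x≡y x y∈⁅x⁆)) x∈p)

p─q-empty⇒p⊆q : ∀ {p q : Subset n} → Empty (p ─ q) → p ⊆ q
p─q-empty⇒p⊆q {q = q} empty {x} x∈p with x ∈? q
... | yes x∈q = x∈q
... | no  x∉q = contradiction (x , x∈p∧x∉q⇒x∈p─q x∈p x∉q) empty

p⊆q∧p≢q⇒p⊂q : ∀ {p q : Subset n} → p ⊆ q → p ≢ q → p ⊂ q
p⊆q∧p≢q⇒p⊂q {p = p} {q} p⊆q p≢q with nonempty? (q ─ p)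
... | yes (x , x∈q─p) = p⊆q , x , p─q⊆p q p x∈q─p , x∈p─q⇒x∉q q p x∈q─p
... | no  empty       = contradiction (⊆-antisym p⊆q (p─q-empty⇒p⊆q empty)) p≢q

fromDec : {Q : Pred (Fin n) 0ℓ} → Decidable₁ Q → Subset n
fromDec Q? = tabulate (does ∘ Q?)

module _ {Q : Pred (Fin n) 0ℓ} (Q? : Decidable₁ Q) where

  ∈-fromDec⁺ : ∀ {x} → Q x → x ∈ₛ fromDec Q?
  ∈-fromDec⁺ {x} q = lookup⇒[]= x _ (trans (lookup∘tabulate (does ∘ Q?) x) (dec-true (Q? x) q))

  ∈-fromDec⁻ : ∀ {x} → x ∈ₛ fromDec Q? → Q x
  ∈-fromDec⁻ {x} x∈ with Q? x | trans (sym (lookup∘tabulate (does ∘ Q?) x)) ([]=⇒lookup x∈)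
  ... | yes q | _ = q
  ... | no _  | ()

⊂-unbounded⇒∅ : {R : Pred (Subset n) 0ℓ} → (∀ {A} → R A → ∃ λ B → R B × A ⊂ B) → ∀ {A} → ¬ R A
⊂-unbounded⇒∅ {R = R} enlarge {A} = go (⊃-wellFounded A)
  where
  go : ∀ {A} → Acc _⊃_ A → ¬ R A
  go (acc rs) RA with B , RB , A⊂B ← enlarge RA = go (rs A⊂B) RB

module Hasse (P : FinPoset n) where
  open FinPoset P
  open IsPartialOrder isPartialOrder
    public using () renaming (refl to ≤P-refl; trans to ≤P-trans; antisym to ≤P-antisym)

  HasseAdj-sym : ∀ {a b} → HasseAdj P a b → HasseAdj P b a
  HasseAdj-sym = swap

  PathIn-mono : ∀ {S T a b} → S ⊆ T → PathIn P S a b → PathIn P T a b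
  PathIn-mono S⊆T here = here
  PathIn-mono S⊆T (step y∈S adj path) = step (S⊆T y∈S) adj (PathIn-mono S⊆T path)

  PathIn-++ : ∀ {S a b c} → PathIn P S a b → PathIn P S b c → PathIn P S a c
  PathIn-++ here q = q
  PathIn-++ (step y∈S adj p) q = step y∈S adj (PathIn-++ p q)

  PathIn-reverse : ∀ {S a b} → a ∈ₛ S → PathIn P S a b → PathIn P S b a
  PathIn-reverse a∈S here = here
  PathIn-reverse a∈S (step y∈S adj p) =
    PathIn-++ (PathIn-reverse y∈S p) (step a∈S (HasseAdj-sym adj) here)

  PathIn-exit : ∀ {S A a w} → PathIn P S a w → a ∈ₛ A → w ∉ₛ A →
                ∃₂ λ u v → u ∈ₛ A × v ∉ₛ A × v ∈ₛ S × HasseAdj P u v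
  PathIn-exit here a∈A a∉A = contradiction a∈A a∉A
  PathIn-exit {A = A} {a = a} (step {y = y} y∈S adj p) a∈A w∉A with y ∈? A
  ... | yes y∈A = PathIn-exit p y∈A w∉A
  ... | no  y∉A = a , y , a∈A , y∉A , y∈S , adj

  <P-trans : ∀ {a b c} → _<P_ P a b → _<P_ P b c → _<P_ P a c
  <P-trans (a≤b , a≢b) (b≤c , _) =
    ≤P-trans a≤b b≤c ,
    λ { refl → a≢b (≤P-antisym a≤b b≤c) }

  module _ (_≤P?_ : Decidable _≤P_) where

    _<P?_ : Decidable (_<P_ P)
    a <P? b = (a ≤P? b) ×-dec ¬? (a ≟ b)

    ∈interval? : ∀ a b → Decidable₁ (λ w → _<P_ P a w × w ≤P b)
    ∈interval? a b w = (a <P? w) ×-dec (w ≤P? b)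

    interval : Fin n → Fin n → Subset n
    interval a b = fromDec (∈interval? a b)

    <P⇒PathIn : ∀ {S a b} → _<P_ P a b → interval a b ⊆ S → PathIn P S a b
    <P⇒PathIn {a = a} {b} = go (⊂-wellFounded (interval a b))
      where
      go : ∀ {S a b} → Acc _⊂_ (interval a b) → _<P_ P a b → interval a b ⊆ S → PathIn P S a b
      go {a = a} {b} (acc rs) a<b I⊆S with any? (λ k → (a <P? k) ×-dec (k <P? b))
      ... | no ∄k = step (I⊆S (∈-fromDec⁺ (∈interval? a b) (a<b , ≤P-refl)))
                         (inj₁ (a<b , λ k a<k k<b → ∄k (k , a<k , k<b))) here
      ... | yes (k , a<k , k<b) =
        PathIn-++ (go (rs lower) a<k (⊆-trans (proj₁ lower) I⊆S))
                  (go (rs upper) k<b (⊆-trans (proj₁ upper) I⊆S))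
        where
        lower : interval a k ⊂ interval a b
        lower = (λ w∈ → let a<w , w≤k = ∈-fromDec⁻ (∈interval? a k) w∈
                        in ∈-fromDec⁺ (∈interval? a b) (a<w , ≤P-trans w≤k (proj₁ k<b))) ,
                b , ∈-fromDec⁺ (∈interval? a b) (a<b , ≤P-refl) ,
                (λ b∈ → proj₂ k<b (≤P-antisym (proj₁ k<b) (proj₂ (∈-fromDec⁻ (∈interval? a k) b∈))))
        upper : interval k b ⊂ interval a b
        upper = (λ w∈ → let k<w , w≤b = ∈-fromDec⁻ (∈interval? k b) w∈
                        in ∈-fromDec⁺ (∈interval? a b) (<P-trans a<k k<w , w≤b)) ,
                k , ∈-fromDec⁺ (∈interval? a b) (a<k , proj₁ k<b) ,
                (λ k∈ → proj₂ (proj₁ (∈-fromDec⁻ (∈interval? k b) k∈)) refl)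

    ≤P⇒PathIn : ∀ {S a b} → a ≤P b → interval a b ⊆ S → PathIn P S a b
    ≤P⇒PathIn {a = a} {b} a≤b I⊆S with a ≟ b
    ... | yes refl = here
    ... | no  a≢b  = <P⇒PathIn (a≤b , a≢b) I⊆S

laminar⇒¬IntersectNontrivially : (P : FinPoset n) {A B : Subset n} →
  (∀ {x} → x ∈ₛ A → x ∈ₛ B → A ⊆ B ⊎ B ⊆ A) → ¬ IntersectNontrivially P A B
laminar⇒¬IntersectNontrivially P {A} {B} nested ((x , x∈A∩B) , A⊈B , B⊈A)
  with x∈A , x∈B ← x∈p∩q⁻ A B x∈A∩B with nested x∈A x∈B
... | inj₁ A⊆B = A⊈B A⊆B
... | inj₂ B⊆A = B⊈A B⊆A

module Below (M : List (Subset n)) where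

  _⊏_ : Subset n → Subset n → Set
  A ⊏ J = A ∈ M × A ⊆ J × A ≢ J

  private
    properlyInside? : (J A : Subset n) → Dec (A ⊆ J × A ≢ J)
    properlyInside? J A = (A ⊆? J) ×-dec ¬? (≡-dec Bool._≟_ A J)

  ∈μ⁺ : ∀ {J A x} → A ⊏ J → x ∈ₛ A → x ∈ₛ μ M J
  ∈μ⁺ {J} (A∈M , A⊆J , A≢J) = x∈⋃⁺ (∈-filter⁺ (properlyInside? J) A∈M (A⊆J , A≢J))

  ∈μ⁻ : ∀ {J x} → x ∈ₛ μ M J → ∃ λ A → A ⊏ J × x ∈ₛ A
  ∈μ⁻ {J} x∈μ with A , A∈filter , x∈A ← x∈⋃⁻ _ x∈μ
    with A∈M , A⊆J , A≢J ← ∈-filter⁻ (properlyInside? J) {xs = M} A∈filter =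
    A , (A∈M , A⊆J , A≢J) , x∈A

module Independent {P : FinPoset n} {M : List (Subset n)} (indep : IsIndependent P M) where
  open FinPoset P
  open Hasse P
  open Below M

  connectedIdeal : ∀ {A} → A ∈ M → IsConnectedIdeal P A
  connectedIdeal = proj₁ (proj₂ indep)

  ideal : ∀ {A} → A ∈ M → IsOrderIdeal P A
  ideal = proj₁ ∘ connectedIdeal

  laminar : ∀ {A B x} → A ∈ M → B ∈ M → x ∈ₛ A → x ∈ₛ B → A ⊆ B ⊎ B ⊆ A
  laminar {A} {B} A∈M B∈M x∈A x∈B with A ⊆? B | B ⊆? A
  ... | yes A⊆B | _       = inj₁ A⊆B
  ... | no _    | yes B⊆A = inj₂ B⊆A
  ... | no A⊈B  | no B⊈A  =
    contradiction ((_ , x∈p∩q⁺ (x∈A , x∈B)) , A⊈B , B⊈A) (proj₂ (proj₂ indep) A∈M B∈M)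

  covered⇒⊏-enlarge : ∀ {J} → J ∈ M → J ⊆ μ M J → ∀ {A} → A ⊏ J → ∃ λ B → B ⊏ J × A ⊂ B
  covered⇒⊏-enlarge {J} J∈M J⊆μ {A} A⊏J@(A∈M , A⊆J , A≢J)
    with _ , w , w∈J , w∉A ← p⊆q∧p≢q⇒p⊂q A⊆J A≢J
       | a , a∈A ← proj₁ (proj₂ (connectedIdeal A∈M))
    with u , v , u∈A , v∉A , v∈J , u~v ← PathIn-exit (proj₂ (proj₂ (connectedIdeal J∈M)) (A⊆J a∈A) w∈J) a∈A w∉A
    with B , B⊏J , v∈B ← ∈μ⁻ (J⊆μ v∈J)
    with laminar A∈M (proj₁ B⊏J) u∈A (u∈B u~v B⊏J v∈B)
    where
    -- Ideals are down-closed, so the Hasse edge u ~ v must point down from v.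
    u∈B : HasseAdj P u v → ∀ {B} → B ⊏ J → v ∈ₛ B → u ∈ₛ B
    u∈B (inj₁ u⋖v) B⊏J v∈B = ideal (proj₁ B⊏J) v∈B u (proj₁ (proj₁ u⋖v))
    u∈B (inj₂ v⋖u) _   _   = contradiction (ideal A∈M u∈A v (proj₁ (proj₁ v⋖u))) v∉A
  ... | inj₁ A⊆B = B , B⊏J , A⊆B , v , v∈B , v∉A
  ... | inj₂ B⊆A = contradiction (B⊆A v∈B) v∉A

  J─μ-nonempty : ∀ {J} → J ∈ M → Nonempty (J ─ μ M J)
  J─μ-nonempty {J} J∈M = decidable-stable (nonempty? (J ─ μ M J)) λ empty →
    let J⊆μ       = p─q-empty⇒p⊆q empty
        z , z∈J   = proj₁ (proj₂ (connectedIdeal J∈M))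
        A , A⊏J , _ = ∈μ⁻ (J⊆μ z∈J)
    in ⊂-unbounded⇒∅ (covered⇒⊏-enlarge J∈M J⊆μ) A⊏J

  J─μ-disjoint : ∀ {Jr Js x} → Jr ∈ M → Js ∈ M → Jr ≢ Js →
                 x ∈ₛ Jr ─ μ M Jr → x ∉ₛ Js ─ μ M Js
  J─μ-disjoint {Jr} {Js} Jr∈M Js∈M Jr≢Js x∈Dr x∈Ds
    with laminar Jr∈M Js∈M (p─q⊆p Jr _ x∈Dr) (p─q⊆p Js _ x∈Ds)
  ... | inj₁ Jr⊆Js = x∈p─q⇒x∉q Js _ x∈Ds (∈μ⁺ (Jr∈M , Jr⊆Js , Jr≢Js) (p─q⊆p Jr _ x∈Dr))
  ... | inj₂ Js⊆Jr = x∈p─q⇒x∉q Jr _ x∈Dr (∈μ⁺ (Js∈M , Js⊆Jr , Jr≢Js ∘ sym) (p─q⊆p Js _ x∈Ds))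

  J─μ-injective : ∀ {Jr Js} → Jr ∈ M → Js ∈ M → Jr ≢ Js → Jr ─ μ M Jr ≢ Js ─ μ M Js
  J─μ-injective Jr∈M Js∈M Jr≢Js Dr≡Ds =
    let j , j∈Dr = J─μ-nonempty Jr∈M
    in J─μ-disjoint Jr∈M Js∈M Jr≢Js j∈Dr (subst (j ∈ₛ_) Dr≡Ds j∈Dr)

  Absorbed : Subset n → Fin n → Pred (Fin n) 0ℓ
  Absorbed J x z = z ≤P x ⊎ ∃ λ A → A ⊏ J × (∃ λ w → w ∈ₛ A × w ≤P x) × z ∈ₛ A

  module Absorb (_≤P?_ : Decidable _≤P_) {J} (J∈M : J ∈ M) {x} (x∈D : x ∈ₛ J ─ μ M J)
                (absorbed? : Decidable₁ (Absorbed J x)) where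

    K : Subset n
    K = fromDec absorbed?

    ∈K⁺ : ∀ {z} → Absorbed J x z → z ∈ₛ K
    ∈K⁺ = ∈-fromDec⁺ absorbed?

    ∈K⁻ : ∀ {z} → z ∈ₛ K → Absorbed J x z
    ∈K⁻ = ∈-fromDec⁻ absorbed?

    x∈K : x ∈ₛ K
    x∈K = ∈K⁺ (inj₁ ≤P-refl)

    ⊏J⊆K : ∀ {A w} → A ⊏ J → w ∈ₛ A → w ≤P x → A ⊆ K
    ⊏J⊆K A⊏J w∈A w≤x z∈A = ∈K⁺ (inj₂ (_ , A⊏J , (_ , w∈A , w≤x) , z∈A))

    K⊆J : K ⊆ J
    K⊆J z∈K with ∈K⁻ z∈K
    ... | inj₁ z≤x                        = ideal J∈M (p─q⊆p J _ x∈D) _ z≤x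
    ... | inj₂ (_ , (_ , A⊆J , _) , _ , z∈A) = A⊆J z∈A

    ∉K : ∀ {y} → y ∉ₛ μ M J → ¬ y ≤P x → y ∉ₛ K
    ∉K y∉μ y≰x y∈K with ∈K⁻ y∈K
    ... | inj₁ y≤x                 = y≰x y≤x
    ... | inj₂ (_ , A⊏J , _ , y∈A) = y∉μ (∈μ⁺ A⊏J y∈A)

    K-ideal : IsOrderIdeal P K
    K-ideal z∈K w w≤z with ∈K⁻ z∈K
    ... | inj₁ z≤x                      = ∈K⁺ (inj₁ (≤P-trans w≤z z≤x))
    ... | inj₂ (A , A⊏J , meets , z∈A) = ∈K⁺ (inj₂ (A , A⊏J , meets , ideal (proj₁ A⊏J) z∈A w w≤z))

    PathIn-≤P : ∀ {z} → z ≤P x → PathIn P K z x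
    PathIn-≤P z≤x = ≤P⇒PathIn _≤P?_ z≤x
      (λ w∈I → ∈K⁺ (inj₁ (proj₂ (∈-fromDec⁻ (∈interval? _≤P?_ _ x) w∈I))))

    PathIn-x : ∀ {z} → z ∈ₛ K → PathIn P K z x
    PathIn-x z∈K with ∈K⁻ z∈K
    ... | inj₁ z≤x = PathIn-≤P z≤x
    ... | inj₂ (A , A⊏J , (w , w∈A , w≤x) , z∈A) =
      PathIn-++ (PathIn-mono (⊏J⊆K A⊏J w∈A w≤x) (proj₂ (proj₂ (connectedIdeal (proj₁ A⊏J))) z∈A w∈A))
                (PathIn-≤P w≤x)

    K-connectedIdeal : IsConnectedIdeal P K
    K-connectedIdeal = K-ideal , (x , x∈K) , λ u∈K v∈K → PathIn-++ (PathIn-x u∈K) (PathIn-reverse v∈K (PathIn-x v∈K))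

    K-laminar : ∀ {A z} → A ∈ M → z ∈ₛ K → z ∈ₛ A → K ⊆ A ⊎ A ⊆ K
    K-laminar {A} A∈M z∈K z∈A with laminar A∈M J∈M z∈A (K⊆J z∈K)
    ... | inj₂ J⊆A = inj₁ (J⊆A ∘ K⊆J)
    ... | inj₁ A⊆J with ≡-dec Bool._≟_ A J
    ... | yes refl = inj₁ K⊆J
    ... | no  A≢J with ∈K⁻ z∈K
    ... | inj₁ z≤x = inj₂ (⊏J⊆K (A∈M , A⊆J , A≢J) z∈A z≤x)
    ... | inj₂ (B , B⊏J , (w , w∈B , w≤x) , z∈B) with laminar A∈M (proj₁ B⊏J) z∈A z∈B
    ... | inj₁ A⊆B = inj₂ (⊏J⊆K B⊏J w∈B w≤x ∘ A⊆B)
    ... | inj₂ B⊆A = inj₂ (⊏J⊆K (A∈M , A⊆J , A≢J) (B⊆A w∈B) w≤x)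

    K∷M-independent : K ≢ J → IsIndependent P (K ∷ M)
    K∷M-independent K≢J = (All.tabulate K≢member ∷ proj₁ indep) , connected , compatible
      where
      K∉M : ¬ K ∈ M
      K∉M K∈M = x∈p─q⇒x∉q J _ x∈D (∈μ⁺ (K∈M , K⊆J , K≢J) x∈K)

      K≢member : ∀ {A} → A ∈ M → K ≢ A
      K≢member A∈M refl = K∉M A∈M

      connected : ∀ {A} → A ∈ K ∷ M → IsConnectedIdeal P A
      connected (here refl) = K-connectedIdeal
      connected (there A∈M) = connectedIdeal A∈M

      compatible : ∀ {A B} → A ∈ K ∷ M → B ∈ K ∷ M → ¬ IntersectNontrivially P A B
      compatible (here refl) (here refl) = laminar⇒¬IntersectNontrivially P (λ _ _ → inj₁ id)
      compatible (here refl) (there B∈M) = laminar⇒¬IntersectNontrivially P (K-laminar B∈M)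
      compatible (there A∈M) (here refl) = laminar⇒¬IntersectNontrivially P (λ z∈A z∈K → swap (K-laminar A∈M z∈K z∈A))
      compatible (there A∈M) (there B∈M) = proj₂ (proj₂ indep) A∈M B∈M

module MaximumIndependent {P : FinPoset n} {M : List (Subset n)} (maximum : IsMaximumIndependent P M) where
  open FinPoset P
  open Hasse P using (≤P-antisym)
  open Below M
  open Independent (proj₁ maximum)

  J─μ-¬¬≤P : Decidable _≤P_ → ∀ {J x y} → J ∈ M →
    x ∈ₛ J ─ μ M J → y ∈ₛ J ─ μ M J → ¬ ¬ y ≤P x
  J─μ-¬¬≤P _≤P?_ {J} {x} {y} J∈M x∈D y∈D y≰x =
    ¬¬-decidable (Absorbed J x) λ absorbed? →
      let open Absorb _≤P?_ J∈M x∈D absorbed?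
          y∉K = ∉K (x∈p─q⇒x∉q J _ y∈D) y≰x
          K≢J = λ K≡J → y∉K (subst (y ∈ₛ_) (sym K≡J) (p─q⊆p J _ y∈D))
      in 1+n≰n (proj₂ maximum (K ∷ M) (K∷M-independent K≢J))

  J─μ-subsingleton : ∀ {J x y} → J ∈ M → x ∈ₛ J ─ μ M J → y ∈ₛ J ─ μ M J → x ≡ y
  J─μ-subsingleton {x = x} {y} J∈M x∈D y∈D =
    decidable-stable (x ≟ y) λ x≢y → ¬¬-decidable₂ _≤P_ λ _≤P?_ →
      J─μ-¬¬≤P _≤P?_ J∈M x∈D y∈D λ y≤x →
      J─μ-¬¬≤P _≤P?_ J∈M y∈D x∈D λ x≤y → x≢y (≤P-antisym x≤y y≤x)

  J─μ-maximal : ∀ {J x} → J ∈ M → x ∈ₛ J ─ μ M J → IsMaximalIn P x J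
  J─μ-maximal {J} {x} J∈M x∈D = p─q⊆p J _ x∈D , above
    where
    above : ∀ t → t ∈ₛ J → x ≤P t → t ≡ x
    above t t∈J x≤t with t ∈? μ M J
    ... | no  t∉μ = J─μ-subsingleton J∈M (x∈p∧x∉q⇒x∈p─q t∈J t∉μ) x∈D
    ... | yes t∈μ with A , A⊏J , t∈A ← ∈μ⁻ t∈μ =
      contradiction (∈μ⁺ A⊏J (ideal (proj₁ A⊏J) t∈A x x≤t)) (x∈p─q⇒x∉q J _ x∈D)

  J─μ-characterisation : ∀ {J x} → J ∈ M → x ∈ₛ J ─ μ M J →
    (J ─ μ M J ≡ ⁅ x ⁆) × (∀ k → J ─ μ M J ≡ ⁅ k ⁆ → k ≡ x) × IsMaximalIn P x J
  J─μ-characterisation {J} {x} J∈M x∈D =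
    x∈p∧p⊆⁅x⁆⇒p≡⁅x⁆ x∈D ≡x ,
    (λ k D≡⁅k⁆ → ≡x (subst (k ∈ₛ_) (sym D≡⁅k⁆) (x∈⁅x⁆ k))) ,
    J─μ-maximal J∈M x∈D
    where
    ≡x : ∀ {k} → k ∈ₛ J ─ μ M J → k ≡ x
    ≡x k∈D = J─μ-subsingleton J∈M k∈D x∈D

lemma2p3 : (n : ℕ) (P : FinPoset n) (M : List (Subset n)) →
    IsMaximumIndependent P M →
    ((J : Subset n) → J ∈ M →
      Σ (Fin n) (λ j → (J ─ μ M J ≡ ⁅ j ⁆)
        × (∀ k → J ─ μ M J ≡ ⁅ k ⁆ → k ≡ j)
        × IsMaximalIn P j J))
    × ((Jr Js : Subset n) → Jr ∈ M → Js ∈ M → Jr ≢ Js →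
      Jr ─ μ M Jr ≢ Js ─ μ M Js)
lemma2p3 n P M maximum =
  (λ J J∈M → let j , j∈D = J─μ-nonempty J∈M in j , J─μ-characterisation J∈M j∈D) ,
  (λ _ _ → J─μ-injective)
  where
  open Independent (proj₁ maximum)
  open MaximumIndependent maximum
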